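{- Let $q$ be a prime power, $\alpha$ a primitive element of $\mathbb{F}_{q^5}$ (identified with $\mathbb{F}_q^5$), $s=\frac{q^5-1}{q-1}$, and $L$ a $2$-dimensional subspace of $\mathbb{F}_q^5$. Let $0\le t<\ell<s$ and let $i,j$ be integers with $i,j\not\equiv0\pmod s$ such that $\alpha^t,\alpha^{t+i},\alpha^\ell,\alpha^{\ell+j}\in L$. Then $i\not\equiv j\pmod s$.
   Context: Note that $\alpha^a$ and $\alpha^b$ span the same $1$-dimensional $\mathbb{F}_q$-subspace iff $a\equiv b\pmod s$. -}

module Defs where

open import Level using (Level; _⊔_; Lift)
open import Data.Unit using (⊤)
open import Relation.Binary.PropositionalEquality using (_≡_)
open import Data.Nat using (ℕ; zero; suc)
open import Data.Fin using (Fin)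
open import Data.Integer using (ℤ; +_; -[1+_])
open import Data.Product using (Σ; ∃; ∃-syntax; _×_; _,_)
open import Relation.Nullary using (¬_)
open import Algebra.Bundles using (CommutativeRing)

record Field (c ℓ : Level) : Set (Level.suc (c ⊔ ℓ)) where
  field
    commutativeRing : CommutativeRing c ℓ
  open CommutativeRing commutativeRing public
  field
    _⁻¹      : Carrier → Carrier
    1#≉0#    : ¬ (1# ≈ 0#)
    ⁻¹-inverse : ∀ x → ¬ (x ≈ 0#) → x * (x ⁻¹) ≈ 1#

module FieldTheory {c ℓ : Level} (F : Field c ℓ) where
  open Field F

  _^_ : Carrier → ℕ → Carrier
  x ^ zero  = 1#
  x ^ suc n = x * (x ^ n)

  _^ᶻ_ : Carrier → ℤ → Carrier
  x ^ᶻ (+ n)      = x ^ n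
  x ^ᶻ -[1+ n ]   = (x ^ suc n) ⁻¹

  HasCard : (Carrier → Set ℓ) → ℕ → Set (c ⊔ ℓ)
  HasCard P n = Σ (Fin n → Carrier) λ f →
      (∀ a → P (f a))
    × (∀ a b → f a ≈ f b → a ≡ b)
    × (∀ x → P x → ∃[ a ] (f a ≈ x))

  FieldCard : ℕ → Set (c ⊔ ℓ)
  FieldCard n = HasCard (λ _ → Lift ℓ ⊤) n

  Primitive : Carrier → Set (c ⊔ ℓ)
  Primitive α = ∀ x → ¬ (x ≈ 0#) → ∃[ n ] (α ^ n ≈ x)

  record IsSubfield (K : Carrier → Set ℓ) : Set (c ⊔ ℓ) where
    field
      resp  : ∀ {x y} → x ≈ y → K x → K y
      zero∈ : K 0#
      one∈  : K 1#
      +∈    : ∀ {x y} → K x → K y → K (x + y)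
      *∈    : ∀ {x y} → K x → K y → K (x * y)
      -∈    : ∀ {x} → K x → K (- x)
      ⁻¹∈   : ∀ {x} → K x → ¬ (x ≈ 0#) → K (x ⁻¹)

  record IsSubspace (K L : Carrier → Set ℓ) : Set (c ⊔ ℓ) where
    field
      resp  : ∀ {x y} → x ≈ y → L x → L y
      zero∈ : L 0#
      +∈    : ∀ {x y} → L x → L y → L (x + y)
      scal∈ : ∀ {a x} → K a → L x → L (a * x)

  HasDim2 : (K L : Carrier → Set ℓ) → Set (c ⊔ ℓ)
  HasDim2 K L = Σ Carrier λ u → Σ Carrier λ v →
      L u × L v
    × (∀ a b → K a → K b → (a * u) + (b * v) ≈ 0# → (a ≈ 0#) × (b ≈ 0#))
    × (∀ x → L x → ∃[ a ] ∃[ b ] (K a × K b × (x ≈ (a * u) + (b * v))))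

  Is2DimSubspace : (K L : Carrier → Set ℓ) → Set (c ⊔ ℓ)
  Is2DimSubspace K L = IsSubspace K L × HasDim2 K L

open import Data.Nat.Primality using (Prime)
import Data.Nat as ℕ
IsPrimePower : ℕ → Set
IsPrimePower q = ∃[ p ] ∃[ k ] (Prime p × 1 ℕ.≤ k × q ≡ p ℕ.^ k)

-- Suppose i ≡ j (mod s) and put β = αⁱ, w = αᵗ and y = αˡ. Since K* is the subgroup of F* generated
-- by αˢ, the hypothesis αˡ⁺ʲ ∈ L gives yβ ∈ L, and β ∉ K because s ∤ i. The independent vectors w and
-- wβ span the plane L; writing y and yβ in this basis, either y is a K-multiple of w, impossible as
-- 0 < ℓ - t < s, or β satisfies a quadratic equation over K. Then K + Kβ is closed under multiplication
-- and has q² elements, so its nonzero elements form a subgroup of the cyclic group F* of order q⁵ - 1.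
-- But q² - 1 does not divide q⁵ - 1 = (q² - 1)(q³ + q) + (q - 1).
module Submission where

open import Level using (Lift; lift; _⊔_)
open import Algebra.Bundles using (CommutativeRing)
open import Algebra.Properties.CommutativeSemigroup using (x∙yz≈y∙xz)
open import Algebra.Solver.Ring.AlmostCommutativeRing
  using (fromCommutativeRing; _-Raw-AlmostCommutative⟶_; Induced-equivalence)
open import Data.Fin using (Fin; remQuot; combine; toℕ; fromℕ<)
import Data.Fin.Properties as Fin
open import Data.Integer as ℤ using (ℤ; +_; -[1+_]; ∣_∣; sign; _◃_; _⊖_)
import Data.Integer.Properties as ℤ
import Data.Integer.Divisibility as ℤᵘ
open import Data.Integer.Divisibility.Signed
  using (∣m∣n⇒∣m-n; ∣m∣n⇒∣m+n; ∣m⇒∣-m; ∣n⇒∣m*n; ∣-refl; ∣-trans; ∣ᵤ⇒∣; ∣⇒∣ᵤ)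
  renaming (_∣_ to _∣ᵢ_; divides to dividesᵢ)
open import Data.Integer.Solver using () renaming (module +-*-Solver to ℤ-Solver)
open import Data.Maybe using (just; nothing)
open import Data.Nat as ℕ using (ℕ; zero; suc; _<_; _≤_; _∸_; s≤s; z≤n; NonZero)
import Data.Nat.Properties as ℕ
open import Data.Nat.Divisibility
  using (_∣_; divides; divides-refl; quotient; m%n≡0⇒n∣m; ∣m+n∣m⇒∣n; m∣m*n; n∣m*n; ∣⇒≤; %-presˡ-∣; ∣1⇒≡1)
open import Data.Nat.DivMod using (_%_; _/_; m≡m%n+[m/n]*n; m%n<n)
open import Data.Nat.Primality using (prime⇒nonZero; prime⇒nonTrivial)
open import Data.Nat.Solver using (module +-*-Solver)
open import Data.Product using (∃-syntax; _×_; _,_; proj₁; proj₂; uncurry)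
open import Data.Sign as Sign using (Sign)
open import Data.Sum using (_⊎_; inj₁; inj₂; [_,_]′)
open import Data.Unit using (⊤; tt)
open import Function using (_∘_)
open import Relation.Binary.Definitions using (WeaklyDecidable; tri<; tri≈; tri>) renaming (Decidable to Decidable₂)
open import Relation.Binary.PropositionalEquality as ≡ using (_≡_)
open import Relation.Nullary using (¬_; Dec; yes; no; contradiction)
open import Relation.Nullary.Decidable using (map′)
open import Relation.Unary using (Decidable)

open import Defs

module ℤ-CoefficientSolver {c ℓ} (R : CommutativeRing c ℓ) where
  private module Embedding where
    open CommutativeRing R
    open import Algebra.Properties.Ring ring
    open import Algebra.Properties.Semiring.Mult.TCOptimised semiring as Mult
      using (×-homo-+; ×1-homo-*; 1+×)
    open import Relation.Binary.Reasoning.Setoid setoid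

    signed : Sign → Carrier → Carrier
    signed Sign.+ x = x
    signed Sign.- x = - x

    signed-cong : ∀ s {x y} → x ≈ y → signed s x ≈ signed s y
    signed-cong Sign.+ x≈y = x≈y
    signed-cong Sign.- x≈y = -‿cong x≈y

    signed-0# : ∀ s → signed s 0# ≈ 0#
    signed-0# Sign.+ = refl
    signed-0# Sign.- = -0#≈0#

    signed-* : ∀ s t x y → signed (s Sign.* t) (x * y) ≈ signed s x * signed t y
    signed-* Sign.+ Sign.+ x y = refl
    signed-* Sign.+ Sign.- x y = -‿distribʳ-* x y
    signed-* Sign.- Sign.+ x y = -‿distribˡ-* x y
    signed-* Sign.- Sign.- x y = begin
      x * y       ≈⟨ *-congʳ (-‿involutive x) ⟨
      - - x * y   ≈⟨ -‿distribˡ-* (- x) y ⟨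
      - (- x * y) ≈⟨ -‿distribʳ-* (- x) y ⟩
      - x * - y   ∎

    -- The optimised multiple makes ⟦ + 1 ⟧ reduce to 1#, so that constants 1 in solver
    -- equations match 1# in goals.
    ⟦_⟧ : ℤ → Carrier
    ⟦ z ⟧ = signed (sign z) (∣ z ∣ Mult.× 1#)

    ◃-homo : ∀ s n → ⟦ s ◃ n ⟧ ≈ signed s (n Mult.× 1#)
    ◃-homo s      zero    = sym (signed-0# s)
    ◃-homo Sign.+ (suc n) = refl
    ◃-homo Sign.- (suc n) = refl

    *-homo : ∀ i j → ⟦ i ℤ.* j ⟧ ≈ ⟦ i ⟧ * ⟦ j ⟧
    *-homo i j = begin
      ⟦ i ℤ.* j ⟧                                                   ≈⟨ ◃-homo s (∣ i ∣ ℕ.* ∣ j ∣) ⟩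
      signed s ((∣ i ∣ ℕ.* ∣ j ∣) Mult.× 1#)                        ≈⟨ signed-cong s (×1-homo-* ∣ i ∣ ∣ j ∣) ⟩
      signed s ((∣ i ∣ Mult.× 1#) * (∣ j ∣ Mult.× 1#))              ≈⟨ signed-* (sign i) (sign j) _ _ ⟩
      ⟦ i ⟧ * ⟦ j ⟧                                                 ∎
      where s = sign i Sign.* sign j

    ⊖-homo : ∀ m n → ⟦ m ⊖ n ⟧ ≈ m Mult.× 1# - n Mult.× 1#
    ⊖-homo zero    zero    = sym (-‿inverseʳ 0#)
    ⊖-homo zero    (suc n) = sym (+-identityˡ _)
    ⊖-homo (suc m) zero    = sym (trans (+-congˡ -0#≈0#) (+-identityʳ _))
    ⊖-homo (suc m) (suc n) = begin
      ⟦ suc m ⊖ suc n ⟧                        ≡⟨ ≡.cong ⟦_⟧ (ℤ.[1+m]⊖[1+n]≡m⊖n m n) ⟩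
      ⟦ m ⊖ n ⟧                                ≈⟨ ⊖-homo m n ⟩
      M - N                                    ≈⟨ +-identityʳ _ ⟨
      (M - N) + 0#                             ≈⟨ +-congˡ (-‿inverseʳ 1#) ⟨
      (M - N) + (1# - 1#)                      ≈⟨ +-assoc _ _ _ ⟩
      M + (- N + (1# - 1#))                    ≈⟨ +-congˡ (+-assoc _ _ _) ⟨
      M + ((- N + 1#) - 1#)                    ≈⟨ +-congˡ (+-congʳ (+-comm _ _)) ⟩
      M + ((1# - N) - 1#)                      ≈⟨ +-congˡ (+-assoc _ _ _) ⟩
      M + (1# + (- N - 1#))                    ≈⟨ +-assoc _ _ _ ⟨
      (M + 1#) + (- N - 1#)                    ≈⟨ +-cong (+-comm _ _) (-‿anti-homo-+ 1# N) ⟨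
      (1# + M) - (1# + N)                      ≈⟨ +-cong (1+× m 1#) (-‿cong (1+× n 1#)) ⟨
      suc m Mult.× 1# - suc n Mult.× 1#        ∎
      where M = m Mult.× 1#; N = n Mult.× 1#

    +-homo : ∀ i j → ⟦ i ℤ.+ j ⟧ ≈ ⟦ i ⟧ + ⟦ j ⟧
    +-homo -[1+ m ] -[1+ n ] = begin
      - (suc (suc (m ℕ.+ n)) Mult.× 1#)                ≡⟨ ≡.cong (λ k → - (suc k Mult.× 1#)) (ℕ.+-suc m n) ⟨
      - ((suc m ℕ.+ suc n) Mult.× 1#)                  ≈⟨ -‿cong (×-homo-+ 1# (suc m) (suc n)) ⟩
      - (suc m Mult.× 1# + suc n Mult.× 1#)            ≈⟨ -‿anti-homo-+ _ _ ⟩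
      - (suc n Mult.× 1#) + - (suc m Mult.× 1#)        ≈⟨ +-comm _ _ ⟩
      - (suc m Mult.× 1#) + - (suc n Mult.× 1#)        ∎
    +-homo -[1+ m ] (+ n)    = trans (⊖-homo n (suc m)) (+-comm _ _)
    +-homo (+ m)    -[1+ n ] = ⊖-homo m (suc n)
    +-homo (+ m)    (+ n)    = ×-homo-+ 1# m n

    -‿homo : ∀ i → ⟦ ℤ.- i ⟧ ≈ - ⟦ i ⟧
    -‿homo -[1+ n ]  = sym (-‿involutive _)
    -‿homo (+ zero)  = sym -0#≈0#
    -‿homo (+ suc n) = refl

    ℤ⟶R : ℤ.+-*-rawRing -Raw-AlmostCommutative⟶ fromCommutativeRing R
    ℤ⟶R = record
      { ⟦_⟧ = ⟦_⟧ ; +-homo = +-homo ; *-homo = *-homo ; -‿homo = -‿homo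
      ; 0-homo = refl ; 1-homo = refl }

    ≟-coefficient : WeaklyDecidable (Induced-equivalence ℤ⟶R)
    ≟-coefficient i j with i ℤ.≟ j
    ... | yes ≡.refl = just refl
    ... | no _       = nothing

  open Embedding using (ℤ⟶R; ≟-coefficient)
  open import Algebra.Solver.Ring ℤ.+-*-rawRing (fromCommutativeRing R) ℤ⟶R ≟-coefficient public

minimal-witness : ∀ {p} {Q : ℕ → Set p} → Decidable Q → ∀ {n} → Q n →
                  ∃[ m ] (Q m × (∀ {k} → k < m → ¬ Q k))
minimal-witness Q? {zero}  Qn = zero , Qn , λ ()
minimal-witness Q? {suc n} Qn with Q? zero
... | yes Q0 = zero , Q0 , λ ()
... | no ¬Q0 with minimal-witness (Q? ∘ suc) Qn
...   | m , Qm , minimal = suc m , Qm , λ { {zero} _ → ¬Q0 ; {suc k} (s≤s k<m) → minimal k<m }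

module LeastPositive {p} (E : ℕ → Set p) (E? : Decidable E)
         (E-+ : ∀ {m n} → E m → E n → E (m ℕ.+ n))
         (P : ℕ) .{{_ : NonZero P}} (E-P : E P)
         (E-periodic : ∀ r m → E (r ℕ.+ m ℕ.* P) → E r) where
  open +-*-Solver

  private
    least : ∃[ m ] (E (suc m) × (∀ {k} → k < m → ¬ E (suc k)))
    least = minimal-witness (E? ∘ suc) (≡.subst E (≡.sym (ℕ.suc-pred P)) E-P)

  -- d and the facts about it are opaque: unfolding them into the search defining d makes later
  -- unification problems blow up.
  opaque
    d : ℕ
    d = suc (proj₁ least)

    instance
      d-nonZero : NonZero d
      d-nonZero = _

    E-d : E d
    E-d = proj₁ (proj₂ least)

    E-<d⇒≡0 : ∀ {r} → E r → r < d → r ≡ 0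
    E-<d⇒≡0 {zero}  _  _         = ≡.refl
    E-<d⇒≡0 {suc r} Er (s≤s r<d) = contradiction Er (proj₂ (proj₂ least) r<d)

  E-0 : E 0
  E-0 = E-periodic 0 1 (≡.subst E (≡.sym (ℕ.+-identityʳ P)) E-P)

  E-* : ∀ k → E (k ℕ.* d)
  E-* zero    = E-0
  E-* (suc k) = E-+ E-d (E-* k)

  E-% : ∀ {n} → E n → E (n % d)
  E-% {n} En = E-periodic (n % d) (q ℕ.* d) (≡.subst E n+[P-1]qd≡r+qdP (E-+ En (E-* (ℕ.pred P ℕ.* q))))
    where
    q : ℕ
    q = n / d
    n+[P-1]qd≡r+qdP : n ℕ.+ ℕ.pred P ℕ.* q ℕ.* d ≡ n % d ℕ.+ q ℕ.* d ℕ.* P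
    n+[P-1]qd≡r+qdP = begin
      n ℕ.+ ℕ.pred P ℕ.* q ℕ.* d                  ≡⟨ ≡.cong (ℕ._+ ℕ.pred P ℕ.* q ℕ.* d) (m≡m%n+[m/n]*n n d) ⟩
      n % d ℕ.+ q ℕ.* d ℕ.+ ℕ.pred P ℕ.* q ℕ.* d  ≡⟨ solve 4 (λ r q d p → r :+ q :* d :+ p :* q :* d := r :+ q :* d :* (con 1 :+ p)) ≡.refl (n % d) q d (ℕ.pred P) ⟩
      n % d ℕ.+ q ℕ.* d ℕ.* suc (ℕ.pred P)        ≡⟨ ≡.cong (λ P′ → n % d ℕ.+ q ℕ.* d ℕ.* P′) (ℕ.suc-pred P) ⟩
      n % d ℕ.+ q ℕ.* d ℕ.* P                     ∎
      where open ≡.≡-Reasoning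

  opaque
    E⇒d∣ : ∀ {n} → E n → d ∣ n
    E⇒d∣ {n} En = m%n≡0⇒n∣m n d (E-<d⇒≡0 (E-% En) (m%n<n n d))

    d∣⇒E : ∀ {n} → d ∣ n → E n
    d∣⇒E (divides-refl k) = E-* k

IsPrimePower⇒≥2 : ∀ {q} → IsPrimePower q → 2 ≤ q
IsPrimePower⇒≥2 (p , suc k , p-prime , _ , ≡.refl) =
  ℕ.≤-trans (ℕ.nonTrivial⇒n>1 p) (ℕ.m≤m*n p (p ℕ.^ k))
  where instance
    _ = prime⇒nonTrivial p-prime
    _ = prime⇒nonZero p-prime
    _ = ℕ.m^n≢0 p k

q≥2⇒q⁵>2 : ∀ {q} → 2 ≤ q → 2 < q ℕ.^ 5
q≥2⇒q⁵>2 q≥2 = ℕ.≤-trans (s≤s (s≤s (s≤s z≤n))) (ℕ.^-monoˡ-≤ 5 q≥2)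

q²∸1∤q⁵∸1 : ∀ {q} → 2 ≤ q → ¬ (q ℕ.* q ∸ 1 ∣ q ℕ.^ 5 ∸ 1)
q²∸1∤q⁵∸1 (s≤s (s≤s {n = w} _)) q²∸1∣q⁵∸1 =
  ℕ.<⇒≱ (ℕ.m<m*n (1 ℕ.+ w) (3 ℕ.+ w) (s≤s (s≤s z≤n))) (∣⇒≤ q²∸1∣q∸1)
  where
  open +-*-Solver
  q : ℕ
  q = 2 ℕ.+ w
  q²∸1≡ : q ℕ.* q ∸ 1 ≡ (1 ℕ.+ w) ℕ.* (3 ℕ.+ w)
  q²∸1≡ = ≡.cong (_∸ 1) (solve 1 (λ w → (con 2 :+ w) :* (con 2 :+ w) := con 1 :+ (con 1 :+ w) :* (con 3 :+ w)) ≡.refl w)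
  q⁵∸1≡ : q ℕ.^ 5 ∸ 1 ≡ (1 ℕ.+ w) ℕ.* (3 ℕ.+ w) ℕ.* (q ℕ.* q ℕ.* q ℕ.+ q) ℕ.+ (1 ℕ.+ w)
  q⁵∸1≡ = ≡.cong (_∸ 1) (solve 1 (λ w → let q = con 2 :+ w in
    q :^ 5 := con 1 :+ ((con 1 :+ w) :* (con 3 :+ w) :* (q :* q :* q :+ q) :+ (con 1 :+ w))) ≡.refl w)
  q²∸1∣q∸1 : (1 ℕ.+ w) ℕ.* (3 ℕ.+ w) ∣ 1 ℕ.+ w
  q²∸1∣q∸1 = ∣m+n∣m⇒∣n (≡.subst₂ _∣_ q²∸1≡ q⁵∸1≡ q²∸1∣q⁵∸1) (m∣m*n (q ℕ.* q ℕ.* q ℕ.+ q))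

-- A record rather than a definition, so that a, b and n can be inferred from a proof.
infix 4 _≡_mod_
record _≡_mod_ (a b : ℤ) (n : ℕ) : Set where
  constructor ≡mod
  field n∣a-b : + n ∣ᵢ a ℤ.- b

module _ {n : ℕ} where
  open ℤ-Solver

  ≡mod-sym : ∀ {a b} → a ≡ b mod n → b ≡ a mod n
  ≡mod-sym {a} {b} (≡mod n∣a-b) = ≡mod (≡.subst (+ n ∣ᵢ_) (solve 2 (λ a b → :- (a :- b) := b :- a) ≡.refl a b) (∣m⇒∣-m n∣a-b))

  ≡mod-trans : ∀ {a b c} → a ≡ b mod n → b ≡ c mod n → a ≡ c mod n
  ≡mod-trans {a} {b} {c} (≡mod n∣a-b) (≡mod n∣b-c) =
    ≡mod (≡.subst (+ n ∣ᵢ_) (solve 3 (λ a b c → (a :- b) :+ (b :- c) := a :- c) ≡.refl a b c) (∣m∣n⇒∣m+n n∣a-b n∣b-c))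

  ∣-resp-≡mod : ∀ {a b} → a ≡ b mod n → + n ∣ᵢ a → + n ∣ᵢ b
  ∣-resp-≡mod {a} {b} (≡mod n∣a-b) n∣a = ≡.subst (+ n ∣ᵢ_) (solve 2 (λ a b → a :- (a :- b) := b) ≡.refl a b) (∣m∣n⇒∣m-n n∣a n∣a-b)

≡mod-weaken : ∀ {m n a b} → m ∣ n → a ≡ b mod n → a ≡ b mod m
≡mod-weaken m∣n (≡mod n∣a-b) = ≡mod (∣-trans (∣ᵤ⇒∣ m∣n) n∣a-b)

-[1+k]-[1+k]*o≡-[1+k]*[1+o] : ∀ k o → -[1+ k ] ℤ.- + (suc k ℕ.* o) ≡ -[1+ k ] ℤ.* + suc o
-[1+k]-[1+k]*o≡-[1+k]*[1+o] k o = begin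
  -[1+ k ] ℤ.- + (suc k ℕ.* o)         ≡⟨ ≡.cong (λ x → -[1+ k ] ℤ.- x) (ℤ.pos-* (suc k) o) ⟩
  -[1+ k ] ℤ.- + suc k ℤ.* + o         ≡⟨ solve 2 (λ a b → :- a :- a :* b := (:- a) :* (con (+ 1) :+ b)) ≡.refl (+ suc k) (+ o) ⟩
  -[1+ k ] ℤ.* + suc o                 ∎
  where open ≡.≡-Reasoning; open ℤ-Solver

[t+z-m]-t*[1+o]≡z-[m+t*o] : ∀ t z m o → ((+ t ℤ.+ z) ℤ.- + m) ℤ.- + t ℤ.* + suc o ≡ z ℤ.- + (m ℕ.+ t ℕ.* o)
[t+z-m]-t*[1+o]≡z-[m+t*o] t z m o = begin
  ((+ t ℤ.+ z) ℤ.- + m) ℤ.- + t ℤ.* + suc o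
    ≡⟨ solve 4 (λ t z m o → ((t :+ z) :- m) :- t :* (con (+ 1) :+ o) := z :- (m :+ t :* o)) ≡.refl (+ t) z (+ m) (+ o) ⟩
  z ℤ.- (+ m ℤ.+ + t ℤ.* + o)                    ≡⟨ ≡.cong (λ n → z ℤ.- (+ m ℤ.+ n)) (ℤ.pos-* t o) ⟨
  z ℤ.- + (m ℕ.+ t ℕ.* o)                        ∎
  where open ≡.≡-Reasoning; open ℤ-Solver

[m-n]+n*[1+o]≡m+n*o : ∀ m n o → (+ m ℤ.- + n) ℤ.+ + n ℤ.* + suc o ≡ + (m ℕ.+ n ℕ.* o)
[m-n]+n*[1+o]≡m+n*o m n o = begin
  (+ m ℤ.- + n) ℤ.+ + n ℤ.* + suc o
    ≡⟨ solve 3 (λ m n o → (m :- n) :+ n :* (con (+ 1) :+ o) := m :+ n :* o) ≡.refl (+ m) (+ n) (+ o) ⟩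
  + m ℤ.+ + n ℤ.* + o      ≡⟨ ≡.cong (λ x → + m ℤ.+ x) (ℤ.pos-* n o) ⟨
  + (m ℕ.+ n ℕ.* o)        ∎
  where open ≡.≡-Reasoning; open ℤ-Solver

module FieldProperties {c ℓ} (F : Field c ℓ) where
  open Field F
  open FieldTheory F
  open import Relation.Binary.Reasoning.Setoid setoid

  x≈0⇒a*x≈0 : ∀ {x} a → x ≈ 0# → a * x ≈ 0#
  x≈0⇒a*x≈0 a x≈0 = trans (*-congˡ x≈0) (zeroʳ a)

  ^-homo-* : ∀ x m n → x ^ (m ℕ.+ n) ≈ x ^ m * x ^ n
  ^-homo-* x zero    n = sym (*-identityˡ _)
  ^-homo-* x (suc m) n = trans (*-congˡ (^-homo-* x m n)) (sym (*-assoc _ _ _))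

  ^-periodic : ∀ {x P} → x ^ P ≈ 1# → ∀ r m → x ^ (r ℕ.+ m ℕ.* P) ≈ x ^ r
  ^-periodic {x} {P} x^P≈1 r m = trans (^-homo-* x r (m ℕ.* P)) (trans (*-congˡ (x^mP≈1 m)) (*-identityʳ _))
    where
    x^mP≈1 : ∀ m → x ^ (m ℕ.* P) ≈ 1#
    x^mP≈1 zero    = refl
    x^mP≈1 (suc m) = trans (^-homo-* x P (m ℕ.* P)) (trans (*-cong x^P≈1 (x^mP≈1 m)) (*-identityʳ 1#))

  *-cancelˡ : ∀ {x y z} → x ≉ 0# → x * y ≈ x * z → y ≈ z
  *-cancelˡ {x} {y} {z} x≉0 xy≈xz = begin
    y                ≈⟨ *-identityˡ y ⟨
    1# * y           ≈⟨ *-congʳ (trans (*-comm _ _) (⁻¹-inverse x x≉0)) ⟨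
    (x ⁻¹ * x) * y   ≈⟨ *-assoc _ _ _ ⟩
    x ⁻¹ * (x * y)   ≈⟨ *-congˡ xy≈xz ⟩
    x ⁻¹ * (x * z)   ≈⟨ *-assoc _ _ _ ⟨
    (x ⁻¹ * x) * z   ≈⟨ *-congʳ (trans (*-comm _ _) (⁻¹-inverse x x≉0)) ⟩
    1# * z           ≈⟨ *-identityˡ z ⟩
    z                ∎

  x*y≉0 : ∀ {x y} → x ≉ 0# → y ≉ 0# → x * y ≉ 0#
  x*y≉0 {x} x≉0 y≉0 xy≈0 = y≉0 (*-cancelˡ x≉0 (trans xy≈0 (sym (zeroʳ x))))

  x^n≉0 : ∀ {x} n → x ≉ 0# → x ^ n ≉ 0#
  x^n≉0 zero    _   = 1#≉0#
  x^n≉0 (suc n) x≉0 = x*y≉0 x≉0 (x^n≉0 n x≉0)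

  ⁻¹-unique : ∀ {x y} → x * y ≈ 1# → y ≈ x ⁻¹
  ⁻¹-unique {x} {y} xy≈1 = *-cancelˡ x≉0 (trans xy≈1 (sym (⁻¹-inverse x x≉0)))
    where
    x≉0 : x ≉ 0#
    x≉0 x≈0 = 1#≉0# (trans (sym xy≈1) (trans (*-congʳ x≈0) (zeroˡ y)))

  HasCard-unique : ∀ {P m n} → HasCard P m → HasCard P n → m ≡ n
  HasCard-unique P∼m P∼n = ℕ.≤-antisym (HasCard-≤ P∼m P∼n) (HasCard-≤ P∼n P∼m)
    where
    HasCard-≤ : ∀ {P m n} → HasCard P m → HasCard P n → m ≤ n
    HasCard-≤ (f , f∈P , f-injective , _) (g , _ , _ , g-onto) =
      Fin.injective⇒≤ λ {a} {b} ga≡gb → f-injective a b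
        (trans (sym (proj₂ (g-onto (f a) (f∈P a))))
          (trans (reflexive (≡.cong g ga≡gb)) (proj₂ (g-onto (f b) (f∈P b)))))

  HasCard⇒Decidable : Decidable₂ _≈_ → ∀ {P n} → (∀ {x y} → x ≈ y → P x → P y) →
                      HasCard P n → Decidable P
  HasCard⇒Decidable _≟_ P-resp (f , f∈P , _ , f-onto) x =
    map′ (λ (a , fa≈x) → P-resp fa≈x (f∈P a)) (f-onto x) (Fin.any? λ a → f a ≟ x)


module SubfieldSpan {c ℓ} (F : Field c ℓ) (_≟_ : Decidable₂ (Field._≈_ F))
         (K : Field.Carrier F → Set ℓ) (K-subfield : FieldTheory.IsSubfield F K) where
  open Field F
  open FieldTheory F
  open FieldProperties F
  open IsSubfield K-subfield renaming (resp to K-resp)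
  open import Algebra.Properties.Ring ring using (-0#≈0#; -‿injective; x∙y⁻¹≈ε⇒x≈y)
  open ℤ-CoefficientSolver commutativeRing
  open import Relation.Binary.Reasoning.Setoid setoid

  Span : Carrier → Carrier → Carrier → Set (c ⊔ ℓ)
  Span u v x = ∃[ a ] ∃[ b ] (K a × K b × x ≈ a * u + b * v)

  Independent : Carrier → Carrier → Set (c ⊔ ℓ)
  Independent u v = ∀ a b → K a → K b → a * u + b * v ≈ 0# → a ≈ 0# × b ≈ 0#

  independent-w-w*β : ∀ {w β} → w ≉ 0# → ¬ K β → Independent w (w * β)
  independent-w-w*β {w} {β} w≉0 β∉K a b a∈K b∈K aw+bwβ≈0 with b ≟ 0#
  ... | yes b≈0 = a≈0 , b≈0
    where
    a≈0 : a ≈ 0#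
    a≈0 = *-cancelˡ w≉0 (begin
      w * a                 ≈⟨ solve 4 (λ w a b β → w :* a := a :* w :+ b :* (w :* β) :- b :* (w :* β)) refl w a b β ⟩
      aw+bwβ - b * (w * β)  ≈⟨ +-cong aw+bwβ≈0 (-‿cong (trans (*-congʳ b≈0) (zeroˡ _))) ⟩
      0# - 0#               ≈⟨ -‿inverseʳ 0# ⟩
      0#                    ≈⟨ zeroʳ w ⟨
      w * 0#                ∎)
      where aw+bwβ = a * w + b * (w * β)
  ... | no b≉0 = contradiction (K-resp -b⁻¹a≈β (-∈ (*∈ (⁻¹∈ b∈K b≉0) a∈K))) β∉K
    where
    a+bβ≈0 : a + b * β ≈ 0#
    a+bβ≈0 = *-cancelˡ w≉0 (begin
      w * (a + b * β)        ≈⟨ solve 4 (λ w a b β → w :* (a :+ b :* β) := a :* w :+ b :* (w :* β)) refl w a b β ⟩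
      a * w + b * (w * β)    ≈⟨ aw+bwβ≈0 ⟩
      0#                     ≈⟨ zeroʳ w ⟨
      w * 0#                 ∎)
    -b⁻¹a≈β : - (b ⁻¹ * a) ≈ β
    -b⁻¹a≈β = begin
      - (b ⁻¹ * a)                             ≈⟨ solve 4 (λ b′ a b β → :- (b′ :* a) := (:- b′) :* (a :+ b :* β) :+ (b :* b′) :* β) refl (b ⁻¹) a b β ⟩
      (- b ⁻¹) * (a + b * β) + (b * b ⁻¹) * β  ≈⟨ +-cong (x≈0⇒a*x≈0 (- b ⁻¹) a+bβ≈0) (*-congʳ (⁻¹-inverse b b≉0)) ⟩
      0# + 1# * β                              ≈⟨ trans (+-identityˡ _) (*-identityˡ β) ⟩
      β                                        ∎

  module _ {u v y₁ y₂ a₁ b₁ a₂ b₂} (a₁∈K : K a₁) (b₁∈K : K b₁) (a₂∈K : K a₂) (b₂∈K : K b₂)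
           (y₁≈ : y₁ ≈ a₁ * u + b₁ * v) (y₂≈ : y₂ ≈ a₂ * u + b₂ * v) where

    independent⇒det≉0 : Independent y₁ y₂ → a₁ * b₂ - a₂ * b₁ ≉ 0#
    independent⇒det≉0 independent det≈0 = 1#≉0# (proj₁ (independent 1# 0# one∈ zero∈ y₁-trivial))
      where
      b₂y₁-b₁y₂≈0 : b₂ * y₁ + (- b₁) * y₂ ≈ 0#
      b₂y₁-b₁y₂≈0 = begin
        b₂ * y₁ + (- b₁) * y₂                                ≈⟨ +-cong (*-congˡ y₁≈) (*-congˡ y₂≈) ⟩
        b₂ * (a₁ * u + b₁ * v) + (- b₁) * (a₂ * u + b₂ * v)
          ≈⟨ solve 6 (λ a₁ b₁ a₂ b₂ u v → b₂ :* (a₁ :* u :+ b₁ :* v) :+ (:- b₁) :* (a₂ :* u :+ b₂ :* v)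
                                         := u :* (a₁ :* b₂ :- a₂ :* b₁)) refl a₁ b₁ a₂ b₂ u v ⟩
        u * (a₁ * b₂ - a₂ * b₁)                              ≈⟨ x≈0⇒a*x≈0 u det≈0 ⟩
        0#                                                   ∎
      a₂y₁-a₁y₂≈0 : a₂ * y₁ + (- a₁) * y₂ ≈ 0#
      a₂y₁-a₁y₂≈0 = begin
        a₂ * y₁ + (- a₁) * y₂                                ≈⟨ +-cong (*-congˡ y₁≈) (*-congˡ y₂≈) ⟩
        a₂ * (a₁ * u + b₁ * v) + (- a₁) * (a₂ * u + b₂ * v)
          ≈⟨ solve 6 (λ a₁ b₁ a₂ b₂ u v → a₂ :* (a₁ :* u :+ b₁ :* v) :+ (:- a₁) :* (a₂ :* u :+ b₂ :* v)
                                         := (:- v) :* (a₁ :* b₂ :- a₂ :* b₁)) refl a₁ b₁ a₂ b₂ u v ⟩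
        (- v) * (a₁ * b₂ - a₂ * b₁)                          ≈⟨ x≈0⇒a*x≈0 (- v) det≈0 ⟩
        0#                                                   ∎
      a₁≈0 : a₁ ≈ 0#
      a₁≈0 = -‿injective (trans (proj₂ (independent a₂ (- a₁) a₂∈K (-∈ a₁∈K) a₂y₁-a₁y₂≈0)) (sym -0#≈0#))
      b₁≈0 : b₁ ≈ 0#
      b₁≈0 = -‿injective (trans (proj₂ (independent b₂ (- b₁) b₂∈K (-∈ b₁∈K) b₂y₁-b₁y₂≈0)) (sym -0#≈0#))
      y₁-trivial : 1# * y₁ + 0# * y₂ ≈ 0#
      y₁-trivial = begin
        1# * y₁ + 0# * y₂    ≈⟨ +-cong (*-identityˡ y₁) (zeroˡ y₂) ⟩
        y₁ + 0#              ≈⟨ +-identityʳ y₁ ⟩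
        y₁                   ≈⟨ y₁≈ ⟩
        a₁ * u + b₁ * v      ≈⟨ +-cong (trans (*-congʳ a₁≈0) (zeroˡ u)) (trans (*-congʳ b₁≈0) (zeroˡ v)) ⟩
        0# + 0#              ≈⟨ +-identityʳ 0# ⟩
        0#                   ∎

    cramer : a₁ * b₂ - a₂ * b₁ ≉ 0# → ∀ {y a₃ b₃} → K a₃ → K b₃ → y ≈ a₃ * u + b₃ * v → Span y₁ y₂ y
    cramer det≉0 {y} {a₃} {b₃} a₃∈K b₃∈K y≈ =
      - (det⁻¹ * k₁) , - (det⁻¹ * k₂) , -∈ (*∈ det⁻¹∈K k₁∈K) , -∈ (*∈ det⁻¹∈K k₂∈K) , sym y≈combination
      where
      k₁ k₂ det det⁻¹ : Carrier
      k₁ = a₂ * b₃ - a₃ * b₂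
      k₂ = a₃ * b₁ - a₁ * b₃
      det = a₁ * b₂ - a₂ * b₁
      det⁻¹ = det ⁻¹
      k₁∈K : K k₁
      k₁∈K = +∈ (*∈ a₂∈K b₃∈K) (-∈ (*∈ a₃∈K b₂∈K))
      k₂∈K : K k₂
      k₂∈K = +∈ (*∈ a₃∈K b₁∈K) (-∈ (*∈ a₁∈K b₃∈K))
      det⁻¹∈K : K det⁻¹
      det⁻¹∈K = ⁻¹∈ (+∈ (*∈ a₁∈K b₂∈K) (-∈ (*∈ a₂∈K b₁∈K))) det≉0
      relation : k₁ * y₁ + k₂ * y₂ + det * y ≈ 0#
      relation = begin
        k₁ * y₁ + k₂ * y₂ + det * y
          ≈⟨ +-cong (+-cong (*-congˡ y₁≈) (*-congˡ y₂≈)) (*-congˡ y≈) ⟩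
        k₁ * (a₁ * u + b₁ * v) + k₂ * (a₂ * u + b₂ * v) + det * (a₃ * u + b₃ * v)
          ≈⟨ solve 8 (λ a₁ b₁ a₂ b₂ a₃ b₃ u v →
               (a₂ :* b₃ :- a₃ :* b₂) :* (a₁ :* u :+ b₁ :* v) :+ (a₃ :* b₁ :- a₁ :* b₃) :* (a₂ :* u :+ b₂ :* v)
                 :+ (a₁ :* b₂ :- a₂ :* b₁) :* (a₃ :* u :+ b₃ :* v) := con (+ 0)) refl a₁ b₁ a₂ b₂ a₃ b₃ u v ⟩
        0#  ∎
      y≈combination : - (det⁻¹ * k₁) * y₁ + - (det⁻¹ * k₂) * y₂ ≈ y
      y≈combination = begin
        - (det⁻¹ * k₁) * y₁ + - (det⁻¹ * k₂) * y₂
          ≈⟨ solve 7 (λ z k₁ k₂ d y₁ y₂ y → (:- (z :* k₁)) :* y₁ :+ (:- (z :* k₂)) :* y₂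
                 := (:- z) :* (k₁ :* y₁ :+ k₂ :* y₂ :+ d :* y) :+ (d :* z) :* y) refl det⁻¹ k₁ k₂ det y₁ y₂ y ⟩
        (- det⁻¹) * (k₁ * y₁ + k₂ * y₂ + det * y) + (det * det⁻¹) * y
          ≈⟨ +-cong (x≈0⇒a*x≈0 (- det⁻¹) relation) (*-congʳ (⁻¹-inverse det det≉0)) ⟩
        0# + 1# * y    ≈⟨ trans (+-identityˡ _) (*-identityˡ y) ⟩
        y              ∎

  independent-pair-spans : ∀ {L} → HasDim2 K L → ∀ {y₁ y₂ y} → L y₁ → L y₂ → Independent y₁ y₂ →
                           L y → Span y₁ y₂ y
  independent-pair-spans (_ , _ , _ , _ , _ , coordinates) y₁∈L y₂∈L independent y∈L
    with coordinates _ y₁∈L | coordinates _ y₂∈L | coordinates _ y∈L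
  ... | a₁ , b₁ , a₁∈K , b₁∈K , y₁≈ | a₂ , b₂ , a₂∈K , b₂∈K , y₂≈ | a₃ , b₃ , a₃∈K , b₃∈K , y≈ =
    cramer a₁∈K b₁∈K a₂∈K b₂∈K y₁≈ y₂≈
      (independent⇒det≉0 a₁∈K b₁∈K a₂∈K b₂∈K y₁≈ y₂≈ independent) a₃∈K b₃∈K y≈

  proportional-or-quadratic : ∀ {L} → HasDim2 K L → ∀ {w y β} → w ≉ 0# → ¬ K β →
                              L w → L (w * β) → L y → L (y * β) →
                              (∃[ k ] (K k × y ≈ k * w)) ⊎ Span 1# β (β * β)
  proportional-or-quadratic {L} dim {w} {y} {β} w≉0 β∉K w∈L wβ∈L y∈L yβ∈L = decide (spans y∈L) (spans yβ∈L)
    where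
    spans : ∀ {x} → L x → Span w (w * β) x
    spans = independent-pair-spans dim w∈L wβ∈L (independent-w-w*β w≉0 β∉K)
    decide : Span w (w * β) y → Span w (w * β) (y * β) → (∃[ k ] (K k × y ≈ k * w)) ⊎ Span 1# β (β * β)
    decide (k₁ , k₂ , k₁∈K , k₂∈K , y≈) (h₁ , h₂ , h₁∈K , h₂∈K , yβ≈) with k₂ ≟ 0#
    ... | yes k₂≈0 = inj₁ (k₁ , k₁∈K , trans y≈ (trans (+-congˡ (trans (*-congʳ k₂≈0) (zeroˡ _))) (+-identityʳ _)))
    ... | no k₂≉0  = inj₂ (z * h₁ , z * h₂ - z * k₁ , *∈ z∈K h₁∈K , +∈ (*∈ z∈K h₂∈K) (-∈ (*∈ z∈K k₁∈K)) , β²≈)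
      where
      z : Carrier
      z = k₂ ⁻¹
      z∈K : K z
      z∈K = ⁻¹∈ k₂∈K k₂≉0
      k₁β+k₂β²≈h₁+h₂β : k₁ * β + k₂ * (β * β) ≈ h₁ + h₂ * β
      k₁β+k₂β²≈h₁+h₂β = *-cancelˡ w≉0 (begin
        w * (k₁ * β + k₂ * (β * β))   ≈⟨ solve 4 (λ w k₁ k₂ β → w :* (k₁ :* β :+ k₂ :* (β :* β)) := (k₁ :* w :+ k₂ :* (w :* β)) :* β) refl w k₁ k₂ β ⟩
        (k₁ * w + k₂ * (w * β)) * β   ≈⟨ *-congʳ y≈ ⟨
        y * β                         ≈⟨ yβ≈ ⟩
        h₁ * w + h₂ * (w * β)         ≈⟨ solve 4 (λ w h₁ h₂ β → h₁ :* w :+ h₂ :* (w :* β) := w :* (h₁ :+ h₂ :* β)) refl w h₁ h₂ β ⟩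
        w * (h₁ + h₂ * β)             ∎)
      β²≈ : β * β ≈ z * h₁ * 1# + (z * h₂ - z * k₁) * β
      β²≈ = begin
        β * β                                  ≈⟨ *-identityˡ _ ⟨
        1# * (β * β)                           ≈⟨ *-congʳ (⁻¹-inverse k₂ k₂≉0) ⟨
        (k₂ * z) * (β * β)                     ≈⟨ solve 4 (λ z k₁ k₂ β → (k₂ :* z) :* (β :* β) := z :* (k₁ :* β :+ k₂ :* (β :* β)) :- z :* k₁ :* β) refl z k₁ k₂ β ⟩
        z * (k₁ * β + k₂ * (β * β)) - z * k₁ * β  ≈⟨ +-congʳ (*-congˡ k₁β+k₂β²≈h₁+h₂β) ⟩
        z * (h₁ + h₂ * β) - z * k₁ * β            ≈⟨ solve 5 (λ z h₁ h₂ k₁ β → z :* (h₁ :+ h₂ :* β) :- z :* k₁ :* β := z :* h₁ :* con (+ 1) :+ (z :* h₂ :- z :* k₁) :* β) refl z h₁ h₂ k₁ β ⟩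
        z * h₁ * 1# + (z * h₂ - z * k₁) * β       ∎

  0∈Span : ∀ {u v} → Span u v 0#
  0∈Span {u} {v} = 0# , 0# , zero∈ , zero∈ , solve 2 (λ u v → con (+ 0) := con (+ 0) :* u :+ con (+ 0) :* v) refl u v

  1∈Span-1 : ∀ {v} → Span 1# v 1#
  1∈Span-1 {v} = 1# , 0# , one∈ , zero∈ , solve 1 (λ v → con (+ 1) := con (+ 1) :* con (+ 1) :+ con (+ 0) :* v) refl v

  Span-1-β-*-closed : ∀ {β} → Span 1# β (β * β) → ∀ {x y} → Span 1# β x → Span 1# β y → Span 1# β (x * y)
  Span-1-β-*-closed {β} (e , f , e∈K , f∈K , β²≈) {x} {y} (a , b , a∈K , b∈K , x≈) (c , d , c∈K , d∈K , y≈) =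
    a * c + b * d * e , a * d + b * c + b * d * f ,
    +∈ (*∈ a∈K c∈K) (*∈ (*∈ b∈K d∈K) e∈K) , +∈ (+∈ (*∈ a∈K d∈K) (*∈ b∈K c∈K)) (*∈ (*∈ b∈K d∈K) f∈K) ,
    (begin
      x * y                                                ≈⟨ *-cong x≈ y≈ ⟩
      (a * 1# + b * β) * (c * 1# + d * β)
        ≈⟨ solve 5 (λ a b c d β → (a :* con (+ 1) :+ b :* β) :* (c :* con (+ 1) :+ d :* β)
                                := a :* c :+ (a :* d :+ b :* c) :* β :+ b :* d :* (β :* β)) refl a b c d β ⟩
      a * c + (a * d + b * c) * β + b * d * (β * β)        ≈⟨ +-congˡ (*-congˡ β²≈) ⟩
      a * c + (a * d + b * c) * β + b * d * (e * 1# + f * β)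
        ≈⟨ solve 7 (λ a b c d β e f → a :* c :+ (a :* d :+ b :* c) :* β :+ b :* d :* (e :* con (+ 1) :+ f :* β)
                                    := (a :* c :+ b :* d :* e) :* con (+ 1) :+ (a :* d :+ b :* c :+ b :* d :* f) :* β)
             refl a b c d β e f ⟩
      (a * c + b * d * e) * 1# + (a * d + b * c + b * d * f) * β ∎)

  module Enumerated {q} (K-card : HasCard K q) where
    private
      g : Fin q → Carrier
      g = proj₁ K-card
      g∈K : ∀ a → K (g a)
      g∈K = proj₁ (proj₂ K-card)
      g-injective : ∀ a b → g a ≈ g b → a ≡ b
      g-injective = proj₁ (proj₂ (proj₂ K-card))
      g-onto : ∀ x → K x → ∃[ a ] (g a ≈ x)
      g-onto = proj₂ (proj₂ (proj₂ K-card))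

    combination : Carrier → Carrier → Fin q × Fin q → Carrier
    combination u v (a , b) = g a * u + g b * v

    -- Coefficients are indices into the enumeration of K, so that Spanᶠ u v lives in Set ℓ, as HasCard requires.
    Spanᶠ : Carrier → Carrier → Carrier → Set ℓ
    Spanᶠ u v x = ∃[ ab ] (x ≈ combination u v ab)

    Spanᶠ-resp : ∀ {u v x y} → x ≈ y → Spanᶠ u v x → Spanᶠ u v y
    Spanᶠ-resp x≈y (ab , x≈) = ab , trans (sym x≈y) x≈

    Spanᶠ⇒Span : ∀ {u v x} → Spanᶠ u v x → Span u v x
    Spanᶠ⇒Span ((a , b) , x≈) = g a , g b , g∈K a , g∈K b , x≈

    Span⇒Spanᶠ : ∀ {u v x} → Span u v x → Spanᶠ u v x
    Span⇒Spanᶠ (a , b , a∈K , b∈K , x≈) with g-onto a a∈K | g-onto b b∈K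
    ... | i , gi≈a | j , gj≈b = (i , j) , trans x≈ (+-cong (*-congʳ (sym gi≈a)) (*-congʳ (sym gj≈b)))

    combination-injective : ∀ {u v} → Independent u v → ∀ ab cd →
                            combination u v ab ≈ combination u v cd → ab ≡ cd
    combination-injective {u} {v} independent (a , b) (c , d) eq =
      ≡.cong₂ _,_ (g-injective a c (x∙y⁻¹≈ε⇒x≈y _ _ (proj₁ differences≈0)))
                  (g-injective b d (x∙y⁻¹≈ε⇒x≈y _ _ (proj₂ differences≈0)))
      where
      differences≈0 : g a - g c ≈ 0# × g b - g d ≈ 0#
      differences≈0 = independent (g a - g c) (g b - g d) (+∈ (g∈K a) (-∈ (g∈K c))) (+∈ (g∈K b) (-∈ (g∈K d))) (begin
        (g a - g c) * u + (g b - g d) * v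
          ≈⟨ solve 6 (λ A B C D u v → (A :- C) :* u :+ (B :- D) :* v := (A :* u :+ B :* v) :- (C :* u :+ D :* v)) refl (g a) (g b) (g c) (g d) u v ⟩
        (g a * u + g b * v) - (g c * u + g d * v)   ≈⟨ +-congʳ eq ⟩
        (g c * u + g d * v) - (g c * u + g d * v)   ≈⟨ -‿inverseʳ _ ⟩
        0#                                          ∎)

    Spanᶠ-card : ∀ {u v} → Independent u v → HasCard (Spanᶠ u v) (q ℕ.* q)
    Spanᶠ-card {u} {v} independent = f , (λ i → remQuot q i , refl) , f-injective , f-onto
      where
      f : Fin (q ℕ.* q) → Carrier
      f i = combination u v (remQuot q i)
      f-injective : ∀ i j → f i ≈ f j → i ≡ j
      f-injective i j fi≈fj = ≡.trans (≡.sym (Fin.combine-remQuot {q} q i))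
        (≡.trans (≡.cong (uncurry combine) (combination-injective independent _ _ fi≈fj)) (Fin.combine-remQuot {q} q j))
      f-onto : ∀ x → Spanᶠ u v x → ∃[ i ] (f i ≈ x)
      f-onto x ((a , b) , x≈) =
        combine a b , trans (reflexive (≡.cong (combination u v) (Fin.remQuot-combine a b))) (sym x≈)


module FiniteCyclic {c ℓ} (F : Field c ℓ) {Q} (F-card : FieldTheory.FieldCard F Q) (Q>2 : 2 < Q)
                    {α : Field.Carrier F} (α-primitive : FieldTheory.Primitive F α) where
  open Field F
  open FieldTheory F
  open FieldProperties F
  open import Relation.Binary.Reasoning.Setoid setoid

  private
    enum : Fin Q → Carrier
    enum = proj₁ F-card
    enum-injective : ∀ i j → enum i ≈ enum j → i ≡ j
    enum-injective = proj₁ (proj₂ (proj₂ F-card))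

    index : Carrier → Fin Q
    index x = proj₁ (proj₂ (proj₂ (proj₂ F-card)) x (lift tt))

    enum-index : ∀ x → enum (index x) ≈ x
    enum-index x = proj₂ (proj₂ (proj₂ (proj₂ F-card)) x (lift tt))

  infix 4 _≟_
  _≟_ : Decidable₂ _≈_
  x ≟ y = map′ (λ ix≡iy → trans (sym (enum-index x)) (trans (reflexive (≡.cong enum ix≡iy)) (enum-index y)))
               (λ x≈y → enum-injective _ _ (trans (enum-index x) (trans x≈y (sym (enum-index y)))))
               (index x Fin.≟ index y)

  -- If α were 0, then α-primitive would leave room only for the elements 0 and 1.
  α≉0 : α ≉ 0#
  α≉0 α≈0 = ℕ.<⇒≱ Q>2 (Fin.injective⇒≤ {f = is-nonzero} is-nonzero-injective)
    where
    nonzero⇒≈1 : ∀ {x} → x ≉ 0# → x ≈ 1#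
    nonzero⇒≈1 x≉0 with α-primitive _ x≉0
    ... | zero  , 1≈x    = sym 1≈x
    ... | suc n , αⁿ⁺¹≈x = contradiction (trans (sym αⁿ⁺¹≈x) (trans (*-congʳ α≈0) (zeroˡ _))) x≉0
    zero-or-not : ∀ {x} → Dec (x ≈ 0#) → Fin 2
    zero-or-not (yes _) = Fin.zero
    zero-or-not (no _)  = Fin.suc Fin.zero
    zero-or-not-injective : ∀ {x y} (x≟0 : Dec (x ≈ 0#)) (y≟0 : Dec (y ≈ 0#)) →
                            zero-or-not x≟0 ≡ zero-or-not y≟0 → x ≈ y
    zero-or-not-injective (yes x≈0) (yes y≈0) _ = trans x≈0 (sym y≈0)
    zero-or-not-injective (no x≉0)  (no y≉0)  _ = trans (nonzero⇒≈1 x≉0) (sym (nonzero⇒≈1 y≉0))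
    is-nonzero : Fin Q → Fin 2
    is-nonzero i = zero-or-not (enum i ≟ 0#)
    is-nonzero-injective : ∀ {i j} → is-nonzero i ≡ is-nonzero j → i ≡ j
    is-nonzero-injective {i} {j} eq = enum-injective i j (zero-or-not-injective (enum i ≟ 0#) (enum j ≟ 0#) eq)

  α^n≉0 : ∀ n → α ^ n ≉ 0#
  α^n≉0 n = x^n≉0 n α≉0

  α^m≈α^n⇒α^[n∸m]≈1 : ∀ {m n} → m ≤ n → α ^ m ≈ α ^ n → α ^ (n ∸ m) ≈ 1#
  α^m≈α^n⇒α^[n∸m]≈1 {m} {n} m≤n αᵐ≈αⁿ = *-cancelˡ (α^n≉0 m) (begin
    α ^ m * α ^ (n ∸ m)   ≈⟨ ^-homo-* α m (n ∸ m) ⟨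
    α ^ (m ℕ.+ (n ∸ m))   ≡⟨ ≡.cong (α ^_) (ℕ.m+[n∸m]≡n m≤n) ⟩
    α ^ n                 ≈⟨ αᵐ≈αⁿ ⟨
    α ^ m                 ≈⟨ *-identityʳ _ ⟨
    α ^ m * 1#            ∎)

  private
    period : ∃[ P ] (0 < P × α ^ P ≈ 1#)
    period with Fin.pigeonhole (ℕ.n<1+n Q) (λ i → index (α ^ toℕ i))
    ... | i , j , i<j , same-index = toℕ j ∸ toℕ i , ℕ.m<n⇒0<n∸m i<j , α^m≈α^n⇒α^[n∸m]≈1 (ℕ.<⇒≤ i<j)
      (trans (sym (enum-index _)) (trans (reflexive (≡.cong enum same-index)) (enum-index _)))

    P : ℕ
    P = proj₁ period
    instance
      P-nonZero : NonZero P
      P-nonZero = ℕ.>-nonZero (proj₁ (proj₂ period))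

  open LeastPositive (λ n → α ^ n ≈ 1#) (λ n → α ^ n ≟ 1#)
         (λ {m} {n} αᵐ≈1 αⁿ≈1 → trans (^-homo-* α m n) (trans (*-cong αᵐ≈1 αⁿ≈1) (*-identityʳ 1#)))
         P (proj₂ (proj₂ period)) (λ r m → trans (sym (^-periodic (proj₂ (proj₂ period)) r m)))
    public using () renaming (d to order; d-nonZero to order-nonZero; E-d to α^order≈1; E⇒d∣ to α^n≈1⇒order∣n)

  α^[r+m*order]≈α^r : ∀ r m → α ^ (r ℕ.+ m ℕ.* order) ≈ α ^ r
  α^[r+m*order]≈α^r = ^-periodic {α} {order} α^order≈1

  α^m≉α^n : ∀ {m n} → m < n → n < order → α ^ m ≉ α ^ n
  α^m≉α^n {m} {n} m<n n<order αᵐ≈αⁿ =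
    ℕ.<⇒≱ (ℕ.≤-<-trans (ℕ.m∸n≤m n m) n<order)
      (∣⇒≤ {{ℕ.>-nonZero (ℕ.m<n⇒0<n∸m m<n)}} (α^n≈1⇒order∣n (α^m≈α^n⇒α^[n∸m]≈1 (ℕ.<⇒≤ m<n) αᵐ≈αⁿ)))

  ^-injective : ∀ {m n} → m < order → n < order → α ^ m ≈ α ^ n → m ≡ n
  ^-injective {m} {n} m<order n<order αᵐ≈αⁿ with ℕ.<-cmp m n
  ... | tri< m<n _ _ = contradiction αᵐ≈αⁿ (α^m≉α^n m<n n<order)
  ... | tri≈ _ m≡n _ = m≡n
  ... | tri> _ _ n<m = contradiction (sym αᵐ≈αⁿ) (α^m≉α^n n<m m<order)

  module Submonoid {S : Carrier → Set ℓ} (S-resp : ∀ {x y} → x ≈ y → S x → S y)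
                   (0∈S : S 0#) (1∈S : S 1#) (S-*-closed : ∀ {x y} → S x → S y → S (x * y))
                   {n} (S-card : HasCard S n) where
    private
      α^order∈S : S (α ^ order)
      α^order∈S = S-resp (sym α^order≈1) 1∈S

    open LeastPositive (λ m → S (α ^ m)) (λ m → HasCard⇒Decidable _≟_ S-resp S-card (α ^ m))
           (λ {m} {k} Sαᵐ Sαᵏ → S-resp (sym (^-homo-* α m k)) (S-*-closed Sαᵐ Sαᵏ))
           order α^order∈S (λ r m → S-resp (α^[r+m*order]≈α^r r m))
      public using (d; d-nonZero) renaming (E⇒d∣ to α^m∈S⇒d∣m; d∣⇒E to d∣m⇒α^m∈S)

    private
      d∣order : d ∣ order
      d∣order = α^m∈S⇒d∣m {order} α^order∈S
      k : ℕ
      k = quotient d∣order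
      order≡k*d : order ≡ k ℕ.* d
      order≡k*d = _∣_.equality d∣order

      enumerate : Fin (suc k) → Carrier
      enumerate Fin.zero    = 0#
      enumerate (Fin.suc a) = α ^ (toℕ a ℕ.* d)

      enumerate∈S : ∀ a → S (enumerate a)
      enumerate∈S Fin.zero    = 0∈S
      enumerate∈S (Fin.suc a) = d∣m⇒α^m∈S (n∣m*n (toℕ a))

      a*d<order : ∀ (a : Fin k) → toℕ a ℕ.* d < order
      a*d<order a = ≡.subst (toℕ a ℕ.* d <_) (≡.sym order≡k*d) (ℕ.*-monoˡ-< d (Fin.toℕ<n a))

      enumerate-injective : ∀ a b → enumerate a ≈ enumerate b → a ≡ b
      enumerate-injective Fin.zero    Fin.zero    _  = ≡.refl
      enumerate-injective Fin.zero    (Fin.suc b) eq = contradiction (sym eq) (α^n≉0 (toℕ b ℕ.* d))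
      enumerate-injective (Fin.suc a) Fin.zero    eq = contradiction eq (α^n≉0 (toℕ a ℕ.* d))
      enumerate-injective (Fin.suc a) (Fin.suc b) eq = ≡.cong Fin.suc (Fin.toℕ-injective
        (ℕ.*-cancelʳ-≡ _ _ d (^-injective (a*d<order a) (a*d<order b) eq)))

      power-enumerated : ∀ m → S (α ^ m) → ∃[ a ] (enumerate (Fin.suc a) ≈ α ^ m)
      power-enumerated m αᵐ∈S = fromℕ< q<k , (begin
          α ^ (toℕ (fromℕ< q<k) ℕ.* d)      ≡⟨ ≡.cong (λ i → α ^ (i ℕ.* d)) (Fin.toℕ-fromℕ< q<k) ⟩
          α ^ (q′ ℕ.* d)                    ≡⟨ ≡.cong (α ^_) (≡.sym (_∣_.equality d∣r)) ⟩
          α ^ r                             ≈⟨ α^[r+m*order]≈α^r r (m / order) ⟨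
          α ^ (r ℕ.+ m / order ℕ.* order)   ≡⟨ ≡.cong (α ^_) (≡.sym (m≡m%n+[m/n]*n m order)) ⟩
          α ^ m                             ∎)
        where
        r : ℕ
        r = m % order
        d∣r : d ∣ r
        d∣r = %-presˡ-∣ (α^m∈S⇒d∣m {m} αᵐ∈S) d∣order
        q′ : ℕ
        q′ = quotient d∣r
        q<k : q′ < k
        q<k = ℕ.*-cancelʳ-< d q′ k (≡.subst₂ _<_ (_∣_.equality d∣r) order≡k*d (m%n<n m order))

      enumerate-onto : ∀ x → S x → ∃[ a ] (enumerate a ≈ x)
      enumerate-onto x x∈S = by-cases (x ≟ 0#)
        where
        by-cases : Dec (x ≈ 0#) → ∃[ a ] (enumerate a ≈ x)
        by-cases (yes x≈0) = Fin.zero , sym x≈0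
        by-cases (no x≉0)  =
          let m , αᵐ≈x = α-primitive x x≉0
              a , αᵃᵈ≈αᵐ = power-enumerated m (S-resp (sym αᵐ≈x) x∈S)
          in Fin.suc a , trans αᵃᵈ≈αᵐ αᵐ≈x

    card-index : (n ∸ 1) ℕ.* d ≡ order
    card-index = ≡.trans (≡.cong (λ m → (m ∸ 1) ℕ.* d) n≡1+k) (≡.sym order≡k*d)
      where
      n≡1+k : n ≡ suc k
      n≡1+k = HasCard-unique S-card (enumerate , enumerate∈S , enumerate-injective , enumerate-onto)

  order≡Q∸1 : order ≡ Q ∸ 1
  order≡Q∸1 = ≡.trans (≡.sym card-index) (≡.trans (≡.cong ((Q ∸ 1) ℕ.*_) d≡1) (ℕ.*-identityʳ _))
    where
    open Submonoid {S = λ _ → Lift ℓ ⊤} (λ _ _ → lift tt) (lift tt) (lift tt) (λ _ _ → lift tt) F-card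
    d≡1 : d ≡ 1
    d≡1 = ∣1⇒≡1 (α^m∈S⇒d∣m {1} (lift tt))

  ^ᶻ-as-^ : ∀ z → ∃[ m ] (α ^ᶻ z ≈ α ^ m × z ≡ + m mod order)
  ^ᶻ-as-^ (+ m)    = m , refl , ≡mod (dividesᵢ (+ 0) (ℤ.+-inverseʳ (+ m)))
  ^ᶻ-as-^ -[1+ k ] = suc k ℕ.* o , sym (⁻¹-unique αᵏ⁺¹*αᵐ≈1) , ≡mod (dividesᵢ -[1+ k ] difference)
    where
    o : ℕ
    o = ℕ.pred order
    αᵏ⁺¹*αᵐ≈1 : α ^ suc k * α ^ (suc k ℕ.* o) ≈ 1#
    αᵏ⁺¹*αᵐ≈1 = begin
      α ^ suc k * α ^ (suc k ℕ.* o)   ≈⟨ ^-homo-* α (suc k) (suc k ℕ.* o) ⟨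
      α ^ (suc k ℕ.+ suc k ℕ.* o)     ≡⟨ ≡.cong (α ^_) (≡.trans (≡.sym (ℕ.*-suc (suc k) o)) (≡.cong (suc k ℕ.*_) (ℕ.suc-pred order))) ⟩
      α ^ (0 ℕ.+ suc k ℕ.* order)     ≈⟨ α^[r+m*order]≈α^r 0 (suc k) ⟩
      1#                              ∎
    difference : -[1+ k ] ℤ.- + (suc k ℕ.* o) ≡ -[1+ k ] ℤ.* + order
    difference = ≡.trans (-[1+k]-[1+k]*o≡-[1+k]*[1+o] k o) (≡.cong (λ n → -[1+ k ] ℤ.* + n) (ℕ.suc-pred order))

  ^ᶻ-factor : ∀ t z → ∃[ n ] (α ^ᶻ (+ t ℤ.+ z) ≈ α ^ t * α ^ n × z ≡ + n mod order)
  ^ᶻ-factor t z = factor (^ᶻ-as-^ (+ t ℤ.+ z))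
    where
    o : ℕ
    o = ℕ.pred order
    factor : ∃[ m ] (α ^ᶻ (+ t ℤ.+ z) ≈ α ^ m × + t ℤ.+ z ≡ + m mod order) →
             ∃[ n ] (α ^ᶻ (+ t ℤ.+ z) ≈ α ^ t * α ^ n × z ≡ + n mod order)
    factor (m , αᶻ≈αᵐ , ≡mod order∣t+z-m) =
      m ℕ.+ t ℕ.* o , trans αᶻ≈αᵐ αᵐ≈αᵗ*αⁿ ,
      ≡mod (≡.subst (+ order ∣ᵢ_) difference (∣m∣n⇒∣m-n order∣t+z-m (∣n⇒∣m*n (+ t) ∣-refl)))
      where
      αᵐ≈αᵗ*αⁿ : α ^ m ≈ α ^ t * α ^ (m ℕ.+ t ℕ.* o)
      αᵐ≈αᵗ*αⁿ = begin
        α ^ m                           ≈⟨ α^[r+m*order]≈α^r m t ⟨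
        α ^ (m ℕ.+ t ℕ.* order)         ≡⟨ ≡.cong (λ n → α ^ (m ℕ.+ t ℕ.* n)) (ℕ.suc-pred order) ⟨
        α ^ (m ℕ.+ t ℕ.* suc o)         ≡⟨ ≡.cong (α ^_) (solve 3 (λ m t o → m :+ t :* (con 1 :+ o) := t :+ (m :+ t :* o)) ≡.refl m t o) ⟩
        α ^ (t ℕ.+ (m ℕ.+ t ℕ.* o))     ≈⟨ ^-homo-* α t _ ⟩
        α ^ t * α ^ (m ℕ.+ t ℕ.* o)     ∎
        where open +-*-Solver
      difference : ((+ t ℤ.+ z) ℤ.- + m) ℤ.- + t ℤ.* + order ≡ z ℤ.- + (m ℕ.+ t ℕ.* o)
      difference = ≡.trans (≡.cong (λ n → ((+ t ℤ.+ z) ℤ.- + m) ℤ.- + t ℤ.* + n) (≡.sym (ℕ.suc-pred order)))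
                           ([t+z-m]-t*[1+o]≡z-[m+t*o] t z m o)

module QuinticExtension {c ℓ} (F : Field c ℓ) {K : Field.Carrier F → Set ℓ}
         (K-subfield : FieldTheory.IsSubfield F K) {q} (K-card : FieldTheory.HasCard F K q) (q≥2 : 2 ≤ q)
         (F-card : FieldTheory.FieldCard F (q ℕ.^ 5))
         {α : Field.Carrier F} (α-primitive : FieldTheory.Primitive F α) where
  open Field F
  open FieldTheory F
  open FieldProperties F
  open IsSubfield K-subfield renaming (resp to K-resp)
  open FiniteCyclic F F-card (q≥2⇒q⁵>2 q≥2) α-primitive public
  open SubfieldSpan F _≟_ K K-subfield public
  open Enumerated K-card
  open import Relation.Binary.Reasoning.Setoid setoid

  no-quadratic-element : ∀ {β} → ¬ K β → ¬ Span 1# β (β * β)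
  no-quadratic-element {β} β∉K β²∈ =
    q²∸1∤q⁵∸1 q≥2 (divides d (≡.trans (≡.sym order≡Q∸1) (≡.trans (≡.sym card-index) (ℕ.*-comm _ d))))
    where
    independent-1-β : Independent 1# β
    independent-1-β a b a∈K b∈K a+bβ≈0 =
      independent-w-w*β 1#≉0# β∉K a b a∈K b∈K (trans (+-congˡ (*-congˡ (*-identityˡ β))) a+bβ≈0)
    open Submonoid {S = Spanᶠ 1# β} Spanᶠ-resp (Span⇒Spanᶠ 0∈Span) (Span⇒Spanᶠ 1∈Span-1)
           (λ x∈ y∈ → Span⇒Spanᶠ (Span-1-β-*-closed β²∈ (Spanᶠ⇒Span x∈) (Spanᶠ⇒Span y∈)))
           (Spanᶠ-card independent-1-β)

  module Exponents {s} (s*[q∸1]≡q⁵∸1 : s ℕ.* (q ∸ 1) ≡ q ℕ.^ 5 ∸ 1) where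
    private
      instance
        q∸1-nonZero : NonZero (q ∸ 1)
        q∸1-nonZero = ℕ.>-nonZero (ℕ.m<n⇒0<n∸m q≥2)
      open Submonoid K-resp zero∈ one∈ *∈ K-card
      d≡s : d ≡ s
      d≡s = ℕ.*-cancelʳ-≡ d s (q ∸ 1)
              (≡.trans (ℕ.*-comm d (q ∸ 1)) (≡.trans card-index (≡.trans order≡Q∸1 (≡.sym s*[q∸1]≡q⁵∸1))))

    α^n∈K⇒s∣n : ∀ {n} → K (α ^ n) → s ∣ n
    α^n∈K⇒s∣n {n} = ≡.subst (_∣ n) d≡s ∘ α^m∈S⇒d∣m {n}

    s∣n⇒α^n∈K : ∀ {n} → s ∣ n → K (α ^ n)
    s∣n⇒α^n∈K = d∣m⇒α^m∈S ∘ ≡.subst (_∣ _) (≡.sym d≡s)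

    s∣order : s ∣ order
    s∣order = divides (q ∸ 1) (≡.trans order≡Q∸1 (≡.trans (≡.sym s*[q∸1]≡q⁵∸1) (ℕ.*-comm s (q ∸ 1))))

    ^ᶻ-factorₛ : ∀ t z → ∃[ n ] (α ^ᶻ (+ t ℤ.+ z) ≈ α ^ t * α ^ n × z ≡ + n mod s)
    ^ᶻ-factorₛ t z = let n , eq , z≡n = ^ᶻ-factor t z in n , eq , ≡mod-weaken s∣order z≡n

    ratio∈K : ∀ {m n} → + m ≡ + n mod s → ∃[ c ] (K c × α ^ m ≈ c * α ^ n)
    ratio∈K {m} {n} (≡mod s∣m-n) = α ^ (m ℕ.+ n ℕ.* o) , s∣n⇒α^n∈K (∣⇒∣ᵤ s∣m+no) , (begin
      α ^ m                              ≈⟨ α^[r+m*order]≈α^r m n ⟨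
      α ^ (m ℕ.+ n ℕ.* order)            ≡⟨ ≡.cong (λ k → α ^ (m ℕ.+ n ℕ.* k)) (ℕ.suc-pred order) ⟨
      α ^ (m ℕ.+ n ℕ.* suc o)            ≡⟨ ≡.cong (α ^_) (solve 3 (λ m n o → m :+ n :* (con 1 :+ o) := (m :+ n :* o) :+ n) ≡.refl m n o) ⟩
      α ^ ((m ℕ.+ n ℕ.* o) ℕ.+ n)        ≈⟨ ^-homo-* α (m ℕ.+ n ℕ.* o) n ⟩
      α ^ (m ℕ.+ n ℕ.* o) * α ^ n        ∎)
      where
      open +-*-Solver
      o : ℕ
      o = ℕ.pred order
      s∣m+no : + s ∣ᵢ + (m ℕ.+ n ℕ.* o)
      s∣m+no = ≡.subst (+ s ∣ᵢ_)
        (≡.trans (≡.cong (λ k → (+ m ℤ.- + n) ℤ.+ + n ℤ.* + k) (≡.sym (ℕ.suc-pred order))) ([m-n]+n*[1+o]≡m+n*o m n o))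
        (∣m∣n⇒∣m+n s∣m-n (∣n⇒∣m*n (+ n) (∣ᵤ⇒∣ s∣order)))

    α^n∉K*α^m : ∀ {m n} → m < n → n < s → ¬ (∃[ k ] (K k × α ^ n ≈ k * α ^ m))
    α^n∉K*α^m {m} {n} m<n n<s (k , k∈K , αⁿ≈kαᵐ) =
      ℕ.<⇒≱ (ℕ.≤-<-trans (ℕ.m∸n≤m n m) n<s)
        (∣⇒≤ {{ℕ.>-nonZero (ℕ.m<n⇒0<n∸m m<n)}} (α^n∈K⇒s∣n (K-resp (sym αⁿ⁻ᵐ≈k) k∈K)))
      where
      αⁿ⁻ᵐ≈k : α ^ (n ∸ m) ≈ k
      αⁿ⁻ᵐ≈k = *-cancelˡ (α^n≉0 m) (begin
        α ^ m * α ^ (n ∸ m)    ≈⟨ ^-homo-* α m (n ∸ m) ⟨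
        α ^ (m ℕ.+ (n ∸ m))    ≡⟨ ≡.cong (α ^_) (ℕ.m+[n∸m]≡n (ℕ.<⇒≤ m<n)) ⟩
        α ^ n                  ≈⟨ αⁿ≈kαᵐ ⟩
        k * α ^ m              ≈⟨ *-comm k _ ⟩
        α ^ m * k              ∎)



lemma7 : ∀ {c l} (F : Field c l) (K L : Field.Carrier F → Set l)
           (q s : ℕ) (α : Field.Carrier F) (t ℓ : ℕ) (i j : ℤ) →
         let open Field F
             open FieldTheory F
         in IsPrimePower q →
            IsSubfield K → HasCard K q → FieldCard (q ℕ.^ 5) →
            Primitive α →
            s ℕ.* (q ∸ 1) ≡ q ℕ.^ 5 ∸ 1 →
            Is2DimSubspace K L →
            t < ℓ → ℓ < s →
            ¬ (+ s ℤᵘ.∣ i) → ¬ (+ s ℤᵘ.∣ j) →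
            L (α ^ t) → L (α ^ᶻ (+ t ℤ.+ i)) →
            L (α ^ ℓ) → L (α ^ᶻ (+ ℓ ℤ.+ j)) →
            ¬ (+ s ℤᵘ.∣ (i ℤ.- j))
lemma7 F K L q s α t ℓ i j q-prime-power K-subfield K-card F-card α-primitive s*[q∸1]≡q⁵∸1
       (L-subspace , L-dim) t<ℓ ℓ<s s∤i _ αᵗ∈L αᵗ⁺ⁱ∈L αˡ∈L αˡ⁺ʲ∈L s∣i-j =
  [ α^n∉K*α^m t<ℓ ℓ<s , no-quadratic-element β∉K ]′
    (proportional-or-quadratic L-dim (α^n≉0 t) β∉K αᵗ∈L αᵗβ∈L αˡ∈L αˡβ∈L)
  where
  open Field F
  open FieldTheory F using (module IsSubspace; _^_)
  open IsSubspace L-subspace renaming (resp to L-resp)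
  open QuinticExtension F K-subfield K-card (IsPrimePower⇒≥2 q-prime-power) F-card α-primitive
  open Exponents {s} s*[q∸1]≡q⁵∸1
  i′ j′ : ℕ
  i′ = proj₁ (^ᶻ-factorₛ t i)
  j′ = proj₁ (^ᶻ-factorₛ ℓ j)
  β : Carrier
  β = α ^ i′
  i≡i′ : i ≡ + i′ mod s
  i≡i′ = proj₂ (proj₂ (^ᶻ-factorₛ t i))
  j≡j′ : j ≡ + j′ mod s
  j≡j′ = proj₂ (proj₂ (^ᶻ-factorₛ ℓ j))

  β∉K : ¬ K β
  β∉K β∈K = s∤i (∣⇒∣ᵤ (∣-resp-≡mod (≡mod-sym i≡i′) (∣ᵤ⇒∣ (α^n∈K⇒s∣n β∈K))))

  αᵗβ∈L : L (α ^ t * β)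
  αᵗβ∈L = L-resp (proj₁ (proj₂ (^ᶻ-factorₛ t i))) αᵗ⁺ⁱ∈L

  αˡβ∈L : L (α ^ ℓ * β)
  αˡβ∈L = scale (ratio∈K {i′} {j′} (≡mod-trans (≡mod-sym i≡i′) (≡mod-trans (≡mod (∣ᵤ⇒∣ s∣i-j)) j≡j′)))
    where
    scale : ∃[ c ] (K c × β ≈ c * α ^ j′) → L (α ^ ℓ * β)
    scale (c , c∈K , β≈cαʲ′) =
      L-resp (trans (x∙yz≈y∙xz *-commutativeSemigroup c (α ^ ℓ) (α ^ j′)) (*-congˡ (sym β≈cαʲ′)))
             (scal∈ c∈K (L-resp (proj₁ (proj₂ (^ᶻ-factorₛ ℓ j))) αˡ⁺ʲ∈L))
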